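{- Let $H$ be an $n$-vertex tightly connected $k$-graph. Then $H$ contains a tight walk of order at most $n^{2k}$ that contains each edge of $H$ as a subwalk.
   Context: A $k$-graph $H$ has edges that are $k$-subsets of $V(H)$. The line graph $\hat H$ has vertex set $E(H)$, with $e,f$ adjacent iff $|e\cap f|=k-1$; $H$ is tightly connected if it has no isolated vertices and $\hat H$ is connected. A tight walk in $H$ is a sequence of vertices $(v_1,\dots,v_t)$ (repetitions allowed) such that for every $1\le i\le t-k+1$ the set $\{v_i,\dots,v_{i+k-1}\}$ is an edge of $H$; its edges are these sets of $k$ consecutive vertices, and its order is $t$. An edge $e$ is contained as a subwalk if $e=\{v_i,\dots,v_{i+k-1}\}$ for some $i$. -}

module Defs where

open import Data.Nat using (ℕ; _+_; _∸_; _≤_)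
open import Data.Fin using (Fin)
open import Data.Fin.Subset using (Subset; ∣_∣; _∩_; _∪_; ⁅_⁆; ⊥; _∈_)
open import Data.List using (List; take; drop; length; foldr)
open import Data.List.Relation.Unary.All using (All)
import Data.List.Membership.Propositional as LM
open import Data.Product using (Σ; _×_; ∃)
open import Relation.Binary.PropositionalEquality using (_≡_)
open import Relation.Binary.Construct.Closure.ReflexiveTransitive using (Star)

record KGraph (n k : ℕ) : Set where
  field
    edges   : List (Subset n)
    uniform : All (λ e → ∣ e ∣ ≡ k) edges
open KGraph public

LineAdj : ∀ {n k} → KGraph n k → Subset n → Subset n → Set
LineAdj {k = k} H e f =
  (e LM.∈ edges H) × (f LM.∈ edges H) × (∣ e ∩ f ∣ ≡ k ∸ 1)

TightlyConnected : ∀ {n k} → KGraph n k → Set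
TightlyConnected {n} H =
  ((v : Fin n) → Σ (Subset n) λ e → (e LM.∈ edges H) × (v ∈ e))
  × (∀ e f → e LM.∈ edges H → f LM.∈ edges H → Star (LineAdj H) e f)

setOf : ∀ {n} → List (Fin n) → Subset n
setOf = foldr (λ x s → ⁅ x ⁆ ∪ s) ⊥

-- The i-th window (0-indexed) of k consecutive vertices: {v_i,...,v_{i+k-1}}.
window : ∀ {n} → ℕ → List (Fin n) → ℕ → Subset n
window k w i = setOf (take k (drop i w))

IsTightWalk : ∀ {n k} → KGraph n k → List (Fin n) → Set
IsTightWalk {k = k} H w = ∀ i → i + k ≤ length w → window k w i LM.∈ edges H

ContainsEdge : ∀ {n} (k : ℕ) → List (Fin n) → Subset n → Set
ContainsEdge k w e = ∃ λ i → (i + k ≤ length w) × (window k w i ≡ e)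

{-# OPTIONS --safe #-}
-- The walk is grown one edge at a time.  Suppose a window L of the walk spans the edge e and f is
-- a neighbour of e in the line graph.  Writing L = A x B with x the vertex of e ∖ f and taking u
-- the vertex of f ∖ e, the list M = A u B spans f.  Every window of L M L is a rotation of L or
-- of M, so replacing that occurrence of L by L M L keeps the walk tight, adds 2k vertices and
-- makes it contain f.  Since the line graph is connected, some uncovered edge neighbours a
-- covered one until every edge is covered.  There are at most n^k distinct edges, so the final
-- length is at most 2k·n^k − k ≤ n^(2k).
module Submission where

open import Defs
import Data.Bool as Bool
open import Data.Empty using (⊥-elim)
open import Data.Fin using (Fin; zero; suc)
open import Data.Fin.Properties using (any?)
open import Data.Fin.Subset using (Subset; ∣_∣; _∩_; _∪_; ⁅_⁆; ⊥; _∈_; _∉_; _⊆_; inside; outside)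
open import Data.Fin.Subset.Properties
  using (_∈?_; ⊆-antisym; p⊂q⇒∣p∣<∣q∣; p⊆q⇒∣p∣≤∣q∣; ∣p∣≤n; ∣p∣≤∣x∷p∣; ∣⊥∣≡0; ∉⊥; x∈⁅x⁆; x∈⁅y⁆⇒x≡y;
         x∈p∪q⁺; x∈p∪q⁻; q⊆p∪q; x∈p∩q⁺; x∈p∩q⁻; p∩q⊆q; ∪-identityˡ; ∪-assoc; ∪-comm; ∩-comm)
open import Data.List using (List; []; _∷_; _++_; take; drop; length; map; allFin; cartesianProductWith; [_])
open import Data.List.Properties
  using (length-++; length-map; length-drop; length-tabulate; take-take; take-all; take++drop≡id)
open import Data.List.Membership.Propositional using (find) renaming (_∈_ to _∈ₗ_; _∉_ to _∉ₗ_)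
open import Data.List.Membership.Propositional.Properties
  using (∈-∃++; ∈-++⁻; ∈-++⁺ˡ; ∈-++⁺ʳ; ∈-map⁺; ∈-allFin; ∈-cartesianProductWith⁺)
open import Data.List.Relation.Unary.All as All using (All; []; _∷_)
open import Data.List.Relation.Unary.All.Properties using (¬Any⇒All¬; ¬All⇒Any¬)
open import Data.List.Relation.Unary.Any using (here; there)
open import Data.List.Relation.Unary.AllPairs using ([]; _∷_)
open import Data.List.Relation.Unary.Unique.Propositional using (Unique)
open import Data.Nat using (ℕ; zero; suc; _+_; _*_; _^_; _≤_; _<_; z≤n; s≤s)
open import Data.Nat.Properties
open import Data.Product using (Σ; _×_; _,_; ∃; ∃₂)
open import Data.Sum using (_⊎_; inj₁; inj₂; [_,_]′)
import Data.Sum as Sum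
open import Data.Vec using ([]; _∷_)
open import Data.Vec.Properties using (≡-dec)
open import Function using (_∘_; id)
open import Relation.Binary.Construct.Closure.ReflexiveTransitive using (Star; ε; _◅_)
open import Relation.Binary.PropositionalEquality hiding ([_])
open import Relation.Nullary using (¬_; yes; no; contradiction)
open import Relation.Nullary.Decidable using (_×-dec_; ¬?; decidable-stable)
open import Relation.Unary using (Decidable)

module _ {A : Set} where

  take-cong-≤ : ∀ {j k} (xs ys : List A) → j ≤ k → take k xs ≡ take k ys → take j xs ≡ take j ys
  take-cong-≤ {j} {k} xs ys j≤k eq = begin
    take j xs            ≡⟨ take-of-take xs ⟨
    take j (take k xs)   ≡⟨ cong (take j) eq ⟩
    take j (take k ys)   ≡⟨ take-of-take ys ⟩
    take j ys            ∎
    where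
      open ≡-Reasoning
      take-of-take : ∀ zs → take j (take k zs) ≡ take j zs
      take-of-take zs = trans (take-take j k zs) (cong (λ m → take m zs) (m≤n⇒m⊓n≡m j≤k))

  take-++-cong : ∀ k (xs : List A) {ys zs} → take k ys ≡ take k zs → take k (xs ++ ys) ≡ take k (xs ++ zs)
  take-++-cong zero    xs       eq = refl
  take-++-cong (suc k) []       eq = eq
  take-++-cong (suc k) (x ∷ xs) {ys} {zs} eq =
    cong (x ∷_) (take-++-cong k xs (take-cong-≤ ys zs (n≤1+n k) eq))

  take-++-of-length : ∀ {k} (xs ys : List A) → length xs ≡ k → take k (xs ++ ys) ≡ xs
  take-++-of-length []       ys refl = refl
  take-++-of-length (x ∷ xs) ys refl = cong (x ∷_) (take-++-of-length xs ys refl)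

  take-++-≤ : ∀ {i} (xs ys : List A) → i ≤ length xs → take i (xs ++ ys) ≡ take i xs
  take-++-≤ {zero}  xs       ys _         = refl
  take-++-≤ {suc i} (x ∷ xs) ys (s≤s i≤n) = cong (x ∷_) (take-++-≤ xs ys i≤n)

  take-length+-++ : ∀ i (xs ys : List A) → take (length xs + i) (xs ++ ys) ≡ xs ++ take i ys
  take-length+-++ i []       ys = refl
  take-length+-++ i (x ∷ xs) ys = cong (x ∷_) (take-length+-++ i xs ys)

  take-drop-++ : ∀ {i k} (xs ys : List A) → length xs ≡ k → i ≤ k →
                 take k (drop i xs ++ ys) ≡ drop i xs ++ take i ys
  take-drop-++ {i} xs ys refl i≤k = begin
    take (length xs) (drop i xs ++ ys)            ≡⟨ cong (λ m → take m (drop i xs ++ ys)) length≡ ⟩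
    take (length (drop i xs) + i) (drop i xs ++ ys) ≡⟨ take-length+-++ i (drop i xs) ys ⟩
    drop i xs ++ take i ys                        ∎
    where
      open ≡-Reasoning
      length≡ : length xs ≡ length (drop i xs) + i
      length≡ = sym (trans (cong (_+ i) (length-drop i xs)) (m∸n+n≡m i≤k))

  drop-++-∷ : ∀ {i} (xs ys : List A) {x y} → length xs < i → drop i (xs ++ x ∷ ys) ≡ drop i (xs ++ y ∷ ys)
  drop-++-∷ {suc i} []       ys _          = refl
  drop-++-∷ {suc i} (_ ∷ xs) ys (s≤s xs<i) = drop-++-∷ xs ys xs<i

  length-take≡ : ∀ {k} (xs : List A) → k ≤ length xs → length (take k xs) ≡ k
  length-take≡ {zero}  xs       _         = refl
  length-take≡ {suc k} (x ∷ xs) (s≤s k≤n) = cong suc (length-take≡ xs k≤n)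

  length-take≡⁻ : ∀ k (xs : List A) → length (take k xs) ≡ k → k ≤ length xs
  length-take≡⁻ zero    xs       _  = z≤n
  length-take≡⁻ (suc k) (x ∷ xs) eq = s≤s (length-take≡⁻ k xs (suc-injective eq))

  length-++-∷ : ∀ (xs : List A) {x ys} → length (xs ++ x ∷ ys) ≡ suc (length (xs ++ ys))
  length-++-∷ []       = refl
  length-++-∷ (_ ∷ xs) = cong suc (length-++-∷ xs)

  length-insert : ∀ (xs ys zs : List A) → length (xs ++ ys ++ zs) ≡ length ys + length (xs ++ zs)
  length-insert []       ys zs = length-++ ys
  length-insert (_ ∷ xs) ys zs = trans (cong suc (length-insert xs ys zs)) (sym (+-suc (length ys) _))

data DifferInOne {A : Set} : List A → List A → Set where
  substitute : ∀ xs ys x y → DifferInOne (xs ++ x ∷ ys) (xs ++ y ∷ ys)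

module _ {A : Set} {xs ys : List A} where

  DifferInOne-sym : DifferInOne xs ys → DifferInOne ys xs
  DifferInOne-sym (substitute us vs x y) = substitute us vs y x

  DifferInOne-length : DifferInOne xs ys → length xs ≡ length ys
  DifferInOne-length (substitute us vs x y) = trans (length-++ us) (sym (length-++ us))

  DifferInOne-straddle : DifferInOne xs ys → ∀ i → take i ys ≡ take i xs ⊎ drop i xs ≡ drop i ys
  DifferInOne-straddle (substitute us vs x y) i with i ≤? length us
  ... | yes i≤us = inj₁ (trans (take-++-≤ us (y ∷ vs) i≤us) (sym (take-++-≤ us (x ∷ vs) i≤us)))
  ... | no  i≰us = inj₂ (drop-++-∷ us vs (≰⇒> i≰us))

module Windows {A : Set} (k : ℕ) where

  data AllWindows (P : List A → Set) : List A → Set where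
    []  : AllWindows P []
    _∷_ : ∀ {x xs} → P (take k (x ∷ xs)) → AllWindows P xs → AllWindows P (x ∷ xs)

  data AnyWindow (P : List A → Set) : List A → Set where
    here  : ∀ {x xs} → P (take k (x ∷ xs)) → AnyWindow P (x ∷ xs)
    there : ∀ {x xs} → AnyWindow P xs → AnyWindow P (x ∷ xs)

  AllWindows-short : ∀ {Q : List A → Set} w → length w < k → AllWindows (λ t → length t ≡ k → Q t) w
  AllWindows-short []      _   = []
  AllWindows-short (x ∷ w) w<k = (λ eq → contradiction (length-take≡⁻ k (x ∷ w) eq) (<⇒≱ w<k))
                               ∷ AllWindows-short w (<-trans (n<1+n _) w<k)

  module _ {P : List A → Set} where

    AllWindows-++⁻ʳ : ∀ xs {ys} → AllWindows P (xs ++ ys) → AllWindows P ys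
    AllWindows-++⁻ʳ []       all = all
    AllWindows-++⁻ʳ (x ∷ xs) (_ ∷ all) = AllWindows-++⁻ʳ xs all

    AllWindows-++⁺ : ∀ xs {ys} → (∀ i → i < length xs → P (take k (drop i xs ++ ys))) →
                     AllWindows P ys → AllWindows P (xs ++ ys)
    AllWindows-++⁺ []       _       all = all
    AllWindows-++⁺ (x ∷ xs) windows all =
      windows 0 (s≤s z≤n) ∷ AllWindows-++⁺ xs (λ i i<n → windows (suc i) (s≤s i<n)) all

    AllWindows-splice : ∀ xs {ys zs} → take k ys ≡ take k zs →
                        AllWindows P (xs ++ ys) → AllWindows P zs → AllWindows P (xs ++ zs)
    AllWindows-splice []       _  _          all = all
    AllWindows-splice (x ∷ xs) eq (p ∷ all₁) all =
      subst P (take-++-cong k (x ∷ xs) eq) p ∷ AllWindows-splice xs eq all₁ all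

    AnyWindow-++⁺ʳ : ∀ xs {ys} → AnyWindow P ys → AnyWindow P (xs ++ ys)
    AnyWindow-++⁺ʳ []       any = any
    AnyWindow-++⁺ʳ (x ∷ xs) any = there (AnyWindow-++⁺ʳ xs any)

    AnyWindow-splice : ∀ xs {ys zs} → take k ys ≡ take k zs → (AnyWindow P ys → AnyWindow P zs) →
                       AnyWindow P (xs ++ ys) → AnyWindow P (xs ++ zs)
    AnyWindow-splice []       _  f any         = f any
    AnyWindow-splice (x ∷ xs) eq f (here p)    = here (subst P (take-++-cong k (x ∷ xs) eq) p)
    AnyWindow-splice (x ∷ xs) eq f (there any) = there (AnyWindow-splice xs eq f any)

    AnyWindow-split : ∀ w → AnyWindow P w → ∃₂ λ xs ys → w ≡ xs ++ ys × P (take k ys)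
    AnyWindow-split w       (here p)    = [] , w , refl , p
    AnyWindow-split (x ∷ w) (there any) =
      let xs , ys , eq , p = AnyWindow-split w any in x ∷ xs , ys , cong (x ∷_) eq , p

Star-exit : ∀ {A : Set} {R : A → A → Set} {P : A → Set} → Decidable P → ∀ {a b} →
            Star R a b → P a → ¬ P b → ∃₂ λ x y → R x y × P x × ¬ P y
Star-exit P? ε                       Pa ¬Pb = contradiction Pa ¬Pb
Star-exit P? (_◅_ {j = y} xRy path) Pa ¬Pb with P? y
... | yes Py  = Star-exit P? path Py ¬Pb
... | no  ¬Py = _ , y , xRy , Pa , ¬Py

Unique⇒length≤ : ∀ {A : Set} {xs ys : List A} → Unique xs → (∀ {x} → x ∈ₗ xs → x ∈ₗ ys) →
                 length xs ≤ length ys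
Unique⇒length≤ {xs = []}     _               _     = z≤n
Unique⇒length≤ {xs = x ∷ xs} (x≢xs ∷ unique) xs⊆ys with ys₁ , ys₂ , refl ← ∈-∃++ (xs⊆ys (here refl)) =
  ≤-trans (s≤s (Unique⇒length≤ unique xs⊆ys₁++ys₂)) (≤-reflexive (sym (length-++-∷ ys₁)))
  where
    xs⊆ys₁++ys₂ : ∀ {y} → y ∈ₗ xs → y ∈ₗ ys₁ ++ ys₂
    xs⊆ys₁++ys₂ y∈xs with ∈-++⁻ ys₁ (xs⊆ys (there y∈xs))
    ... | inj₁ y∈ys₁           = ∈-++⁺ˡ y∈ys₁
    ... | inj₂ (here refl)     = contradiction refl (All.lookup x≢xs y∈xs)
    ... | inj₂ (there y∈ys₂)   = ∈-++⁺ʳ ys₁ y∈ys₂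

length-cartesianProductWith : ∀ {A B C : Set} (f : A → B → C) xs ys →
                              length (cartesianProductWith f xs ys) ≡ length xs * length ys
length-cartesianProductWith f []       ys = refl
length-cartesianProductWith f (x ∷ xs) ys =
  trans (length-++ (map (f x) ys)) (cong₂ _+_ (length-map (f x) ys) (length-cartesianProductWith f xs ys))

tuples : ∀ n → ℕ → List (List (Fin n))
tuples n zero    = [ [] ]
tuples n (suc k) = cartesianProductWith _∷_ (allFin n) (tuples n k)

length-tuples : ∀ n k → length (tuples n k) ≡ n ^ k
length-tuples n zero    = refl
length-tuples n (suc k) =
  trans (length-cartesianProductWith _∷_ (allFin n) (tuples n k))
        (cong₂ _*_ (length-tabulate {n = n} id) (length-tuples n k))

∈-tuples : ∀ {n} (xs : List (Fin n)) → xs ∈ₗ tuples n (length xs)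
∈-tuples []       = here refl
∈-tuples (x ∷ xs) = ∈-cartesianProductWith⁺ _∷_ (∈-allFin x) (∈-tuples xs)

module _ {n : ℕ} where

  x∈⁅y⁆∪p⁻ : ∀ {x} y (p : Subset n) → x ∈ ⁅ y ⁆ ∪ p → x ≡ y ⊎ x ∈ p
  x∈⁅y⁆∪p⁻ y p x∈ = Sum.map₁ (x∈⁅y⁆⇒x≡y y) (x∈p∪q⁻ ⁅ y ⁆ p x∈)

  x∉p⇒∣p∣<∣⁅x⁆∪p∣ : ∀ {x} {p : Subset n} → x ∉ p → ∣ p ∣ < ∣ ⁅ x ⁆ ∪ p ∣
  x∉p⇒∣p∣<∣⁅x⁆∪p∣ {x} {p} x∉p = p⊂q⇒∣p∣<∣q∣ (q⊆p∪q ⁅ x ⁆ p , x , x∈p∪q⁺ (inj₁ (x∈⁅x⁆ x)) , x∉p)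

  p⊆q∧∣q∣≤∣p∣⇒p≡q : ∀ {p q : Subset n} → p ⊆ q → ∣ q ∣ ≤ ∣ p ∣ → p ≡ q
  p⊆q∧∣q∣≤∣p∣⇒p≡q {p} {q} p⊆q ∣q∣≤∣p∣ = ⊆-antisym p⊆q q⊆p
    where
      q⊆p : q ⊆ p
      q⊆p {x} x∈q with x ∈? p
      ... | yes x∈p = x∈p
      ... | no  x∉p = contradiction (p⊂q⇒∣p∣<∣q∣ (p⊆q , x , x∈q , x∉p)) (≤⇒≯ ∣q∣≤∣p∣)

  ∣p∩q∣<∣p∣⇒∃∈p∖q : ∀ (p q : Subset n) → ∣ p ∩ q ∣ < ∣ p ∣ → ∃ λ x → x ∈ p × x ∉ q
  ∣p∩q∣<∣p∣⇒∃∈p∖q p q ∣p∩q∣<∣p∣ with any? (λ x → x ∈? p ×-dec ¬? (x ∈? q))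
  ... | yes witness = witness
  ... | no  none    = contradiction (p⊆q⇒∣p∣≤∣q∣ p⊆p∩q) (<⇒≱ ∣p∩q∣<∣p∣)
    where
      p⊆p∩q : p ⊆ p ∩ q
      p⊆p∩q {x} x∈p = x∈p∩q⁺ (x∈p , decidable-stable (x ∈? q) (λ x∉q → none (x , x∈p , x∉q)))

∣⁅x⁆∪p∣≤1+∣p∣ : ∀ {n} (x : Fin n) (p : Subset n) → ∣ ⁅ x ⁆ ∪ p ∣ ≤ suc ∣ p ∣
∣⁅x⁆∪p∣≤1+∣p∣ zero    (b ∷ p)       rewrite ∪-identityˡ p = s≤s (∣p∣≤∣x∷p∣ b p)
∣⁅x⁆∪p∣≤1+∣p∣ (suc x) (outside ∷ p) = ∣⁅x⁆∪p∣≤1+∣p∣ x p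
∣⁅x⁆∪p∣≤1+∣p∣ (suc x) (inside ∷ p)  = s≤s (∣⁅x⁆∪p∣≤1+∣p∣ x p)

module _ {n : ℕ} where

  setOf-++ : (xs ys : List (Fin n)) → setOf (xs ++ ys) ≡ setOf xs ∪ setOf ys
  setOf-++ []       ys = sym (∪-identityˡ (setOf ys))
  setOf-++ (x ∷ xs) ys = trans (cong (⁅ x ⁆ ∪_) (setOf-++ xs ys)) (sym (∪-assoc ⁅ x ⁆ (setOf xs) (setOf ys)))

  setOf-++-comm : (xs ys : List (Fin n)) → setOf (xs ++ ys) ≡ setOf (ys ++ xs)
  setOf-++-comm xs ys = trans (setOf-++ xs ys) (trans (∪-comm (setOf xs) (setOf ys)) (sym (setOf-++ ys xs)))

  setOf-rotate : ∀ i (xs : List (Fin n)) → setOf (drop i xs ++ take i xs) ≡ setOf xs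
  setOf-rotate i xs = trans (setOf-++-comm (drop i xs) (take i xs)) (cong setOf (take++drop≡id i xs))

  setOf-++-∷ : (xs ys : List (Fin n)) {y : Fin n} → setOf (xs ++ y ∷ ys) ≡ ⁅ y ⁆ ∪ setOf (xs ++ ys)
  setOf-++-∷ xs ys {y} = trans (setOf-++-comm xs (y ∷ ys)) (cong (⁅ y ⁆ ∪_) (setOf-++-comm ys xs))

  ∣setOf∣≤length : (xs : List (Fin n)) → ∣ setOf xs ∣ ≤ length xs
  ∣setOf∣≤length []       = ≤-reflexive (∣⊥∣≡0 n)
  ∣setOf∣≤length (x ∷ xs) = ≤-trans (∣⁅x⁆∪p∣≤1+∣p∣ x (setOf xs)) (s≤s (∣setOf∣≤length xs))

  ∈-setOf⁻ : ∀ {x} (xs : List (Fin n)) → x ∈ setOf xs → x ∈ₗ xs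
  ∈-setOf⁻ []       x∈ = ⊥-elim (∉⊥ x∈)
  ∈-setOf⁻ (y ∷ xs) x∈ = [ here , there ∘ ∈-setOf⁻ xs ]′ (x∈⁅y⁆∪p⁻ y (setOf xs) x∈)

  setOf-straddle : ∀ {xs ys : List (Fin n)} → DifferInOne xs ys → ∀ i →
                   setOf (drop i xs ++ take i ys) ≡ setOf xs ⊎ setOf (drop i xs ++ take i ys) ≡ setOf ys
  setOf-straddle {xs} {ys} d i = Sum.map
    (λ eq → trans (cong (λ t → setOf (drop i xs ++ t)) eq) (setOf-rotate i xs))
    (λ eq → trans (cong (λ t → setOf (t ++ take i ys)) eq) (setOf-rotate i ys))
    (DifferInOne-straddle d i)

toList : ∀ {n} → Subset n → List (Fin n)
toList []            = []
toList (inside  ∷ p) = zero ∷ map suc (toList p)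
toList (outside ∷ p) = map suc (toList p)

setOf-map-suc : ∀ {n} (xs : List (Fin n)) → setOf (map suc xs) ≡ outside ∷ setOf xs
setOf-map-suc []       = refl
setOf-map-suc (x ∷ xs) = cong (⁅ suc x ⁆ ∪_) (setOf-map-suc xs)

setOf-toList : ∀ {n} (p : Subset n) → setOf (toList p) ≡ p
setOf-toList []            = refl
setOf-toList (inside  ∷ p) = begin
  setOf (toList (inside ∷ p))             ≡⟨ cong (⁅ zero ⁆ ∪_) (setOf-map-suc (toList p)) ⟩
  inside ∷ (⊥ ∪ setOf (toList p))         ≡⟨ cong (inside ∷_) (∪-identityˡ (setOf (toList p))) ⟩
  inside ∷ setOf (toList p)               ≡⟨ cong (inside ∷_) (setOf-toList p) ⟩
  inside ∷ p                              ∎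
  where open ≡-Reasoning
setOf-toList (outside ∷ p) = trans (setOf-map-suc (toList p)) (cong (outside ∷_) (setOf-toList p))

length-toList : ∀ {n} (p : Subset n) → length (toList p) ≡ ∣ p ∣
length-toList []            = refl
length-toList (inside  ∷ p) = cong suc (trans (length-map suc (toList p)) (length-toList p))
length-toList (outside ∷ p) = trans (length-map suc (toList p)) (length-toList p)

Unique⇒length≤n^k : ∀ {n k} {C : List (Subset n)} → Unique C → All (λ e → ∣ e ∣ ≡ k) C → length C ≤ n ^ k
Unique⇒length≤n^k {n} {k} {C} unique sizes = begin
  length C                        ≤⟨ Unique⇒length≤ unique C⊆sets ⟩
  length (map setOf (tuples n k)) ≡⟨ length-map setOf (tuples n k) ⟩
  length (tuples n k)             ≡⟨ length-tuples n k ⟩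
  n ^ k                           ∎
  where
    open ≤-Reasoning
    C⊆sets : ∀ {e} → e ∈ₗ C → e ∈ₗ map setOf (tuples n k)
    C⊆sets {e} e∈C = subst (_∈ₗ map setOf (tuples n k)) (setOf-toList e) (∈-map⁺ setOf toList-e∈tuples)
      where
        toList-e∈tuples : toList e ∈ₗ tuples n k
        toList-e∈tuples = subst (λ m → toList e ∈ₗ tuples n m)
                            (trans (length-toList e) (All.lookup sizes e∈C)) (∈-tuples (toList e))

⁅x⁆∪s-exchange : ∀ {n j} {e f s : Subset n} {x u} → e ≡ ⁅ x ⁆ ∪ s → ∣ s ∣ ≤ j → ∣ f ∣ ≡ suc j →
                 ∣ e ∩ f ∣ ≡ j → x ∉ f → u ∈ f → u ∉ e → ⁅ u ⁆ ∪ s ≡ f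
⁅x⁆∪s-exchange {j = j} {e} {f} {s} {x} {u} refl ∣s∣≤j ∣f∣ ∣e∩f∣ x∉f u∈f u∉e =
  p⊆q∧∣q∣≤∣p∣⇒p≡q ⁅u⁆∪s⊆f ∣f∣≤∣⁅u⁆∪s∣
  where
    e∩f⊆s : e ∩ f ⊆ s
    e∩f⊆s y∈e∩f with y∈e , y∈f ← x∈p∩q⁻ e f y∈e∩f with x∈⁅y⁆∪p⁻ x s y∈e
    ... | inj₁ refl = contradiction y∈f x∉f
    ... | inj₂ y∈s  = y∈s
    e∩f≡s : e ∩ f ≡ s
    e∩f≡s = p⊆q∧∣q∣≤∣p∣⇒p≡q e∩f⊆s (subst (∣ s ∣ ≤_) (sym ∣e∩f∣) ∣s∣≤j)
    ⁅u⁆∪s⊆f : ⁅ u ⁆ ∪ s ⊆ f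
    ⁅u⁆∪s⊆f y∈ with x∈⁅y⁆∪p⁻ u s y∈
    ... | inj₁ refl = u∈f
    ... | inj₂ y∈s  = subst (_⊆ f) e∩f≡s (p∩q⊆q e f) y∈s
    ∣f∣≤∣⁅u⁆∪s∣ : ∣ f ∣ ≤ ∣ ⁅ u ⁆ ∪ s ∣
    ∣f∣≤∣⁅u⁆∪s∣ = begin
      ∣ f ∣              ≡⟨ ∣f∣ ⟩
      suc j              ≡⟨ cong suc (trans (sym ∣e∩f∣) (cong ∣_∣ e∩f≡s)) ⟩
      suc ∣ s ∣          ≤⟨ x∉p⇒∣p∣<∣⁅x⁆∪p∣ (u∉e ∘ q⊆p∪q ⁅ x ⁆ s) ⟩
      ∣ ⁅ u ⁆ ∪ s ∣      ∎
      where open ≤-Reasoning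

exchange : ∀ {n j} (L : List (Fin n)) {f : Subset n} → length L ≡ suc j → ∣ setOf L ∣ ≡ suc j →
           ∣ f ∣ ≡ suc j → ∣ setOf L ∩ f ∣ ≡ j → ∃ λ M → DifferInOne L M × setOf M ≡ f
exchange {j = j} L {f} ∣L∣ ∣e∣ ∣f∣ ∣e∩f∣
  with x , x∈e , x∉f ← ∣p∩q∣<∣p∣⇒∃∈p∖q (setOf L) f (subst₂ _<_ (sym ∣e∩f∣) (sym ∣e∣) (n<1+n j))
  with A , B , refl ← ∈-∃++ (∈-setOf⁻ L x∈e)
  with u , u∈f , u∉e ← ∣p∩q∣<∣p∣⇒∃∈p∖q f (setOf L)
                          (subst₂ _<_ (sym (trans (cong ∣_∣ (∩-comm f (setOf L))) ∣e∩f∣)) (sym ∣f∣) (n<1+n j))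
  = A ++ u ∷ B , substitute A B x u ,
    trans (setOf-++-∷ A B) (⁅x⁆∪s-exchange (setOf-++-∷ A B) ∣s∣≤j ∣f∣ ∣e∩f∣ x∉f u∈f u∉e)
  where
    ∣s∣≤j : ∣ setOf (A ++ B) ∣ ≤ j
    ∣s∣≤j = ≤-trans (∣setOf∣≤length (A ++ B)) (≤-reflexive (suc-injective (trans (sym (length-++-∷ A)) ∣L∣)))

2*[1+n]≤2^[1+n] : ∀ n → 2 * suc n ≤ 2 ^ suc n
2*[1+n]≤2^[1+n] zero    = ≤-refl
2*[1+n]≤2^[1+n] (suc n) = begin
  2 * suc (suc n)         ≡⟨ *-suc 2 (suc n) ⟩
  2 + 2 * suc n           ≤⟨ +-mono-≤ (≤-trans (*-monoʳ-≤ 2 (s≤s z≤n)) IH) IH ⟩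
  2 ^ suc n + 2 ^ suc n   ≡⟨ cong (2 ^ suc n +_) (+-identityʳ (2 ^ suc n)) ⟨
  2 ^ suc (suc n)         ∎
  where
    open ≤-Reasoning
    IH = 2*[1+n]≤2^[1+n] n

walk-length-bound : ∀ {m n} j → suc j ≤ n → m + suc j ≤ 2 * suc j * n ^ suc j → m ≤ n ^ (2 * suc j)
walk-length-bound {m} {suc zero} zero (s≤s z≤n) m+1≤2 = +-cancelʳ-≤ 1 m 1 m+1≤2
walk-length-bound {m} {suc (suc n)} j _ le = begin
  m                      ≤⟨ m≤m+n m k ⟩
  m + k                  ≤⟨ le ⟩
  2 * k * N ^ k          ≤⟨ *-monoˡ-≤ (N ^ k) (≤-trans (2*[1+n]≤2^[1+n] j) (^-monoˡ-≤ k (s≤s (s≤s z≤n)))) ⟩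
  N ^ k * N ^ k          ≡⟨ ^-distribˡ-+-* N k k ⟨
  N ^ (k + k)            ≡⟨ cong (λ i → N ^ (k + i)) (+-identityʳ k) ⟨
  N ^ (2 * k)            ∎
  where
    open ≤-Reasoning
    k = suc j
    N = suc (suc n)

module TightWalks {n j : ℕ} (H : KGraph n (suc j)) where

  k : ℕ
  k = suc j

  open Windows {Fin n} k
  open import Data.List.Membership.DecPropositional {A = Subset n} (≡-dec Bool._≟_) using () renaming (_∈?_ to _∈ₗ?_)

  E : List (Subset n)
  E = edges H

  ∣edge∣ : ∀ {e} → e ∈ₗ E → ∣ e ∣ ≡ k
  ∣edge∣ = All.lookup (uniform H)

  EdgeWindow : List (Fin n) → Set
  EdgeWindow t = length t ≡ k → setOf t ∈ₗ E

  TightWalk : List (Fin n) → Set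
  TightWalk = AllWindows EdgeWindow

  WindowOf : Subset n → List (Fin n) → Set
  WindowOf e t = length t ≡ k × setOf t ≡ e

  Visits : List (Fin n) → Subset n → Set
  Visits w e = AnyWindow (WindowOf e) w

  LineConnected : Set
  LineConnected = ∀ e f → e ∈ₗ E → f ∈ₗ E → Star (LineAdj H) e f

  Visits-here : ∀ {e} w → WindowOf e (take k w) → Visits w e
  Visits-here []      (() , _)
  Visits-here (x ∷ w) window = here window

  Visits-split : ∀ w {e} → Visits w e → ∃ λ P → ∃₂ λ L R → w ≡ P ++ L ++ R × WindowOf e L
  Visits-split w visits with P , Q , refl , window ← AnyWindow-split w visits =
    P , take k Q , drop k Q , cong (P ++_) (sym (take++drop≡id k Q)) , window

  TightWalk-edge : ∀ {L} → length L ≡ k → setOf L ∈ₗ E → TightWalk L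
  TightWalk-edge {[]}    () _
  TightWalk-edge {x ∷ L} ∣L∣ L∈E =
    (λ _ → subst (_∈ₗ E) (cong setOf (sym (take-all k (x ∷ L) (≤-reflexive ∣L∣)))) L∈E)
    ∷ AllWindows-short L (≤-reflexive ∣L∣)

  straddle-tight : ∀ {L M} Z → length L ≡ k → length M ≡ k → (∀ i → i < k → setOf (drop i L ++ take i M) ∈ₗ E) →
                   TightWalk (M ++ Z) → TightWalk (L ++ M ++ Z)
  straddle-tight {L} {M} Z ∣L∣ ∣M∣ straddling tight = AllWindows-++⁺ L edge-window tight
    where
      edge-window : ∀ i → i < length L → EdgeWindow (take k (drop i L ++ M ++ Z))
      edge-window i i<L _ = subst (λ t → setOf t ∈ₗ E) (sym take≡) (straddling i i<k)
        where
          i<k : i < k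
          i<k = subst (i <_) ∣L∣ i<L
          take≡ : take k (drop i L ++ M ++ Z) ≡ drop i L ++ take i M
          take≡ = trans (take-drop-++ L (M ++ Z) ∣L∣ (<⇒≤ i<k))
                        (cong (drop i L ++_) (take-++-≤ M Z (subst (i ≤_) (sym ∣M∣) (<⇒≤ i<k))))

  straddle-edge : ∀ {L M} → DifferInOne L M → setOf L ∈ₗ E → setOf M ∈ₗ E →
                  ∀ i → setOf (drop i L ++ take i M) ∈ₗ E
  straddle-edge d L∈E M∈E i =
    [ (λ eq → subst (_∈ₗ E) (sym eq) L∈E) , (λ eq → subst (_∈ₗ E) (sym eq) M∈E) ]′ (setOf-straddle d i)

  module Detour (P : List (Fin n)) {L M : List (Fin n)} (R : List (Fin n))
                (∣L∣ : length L ≡ k) (L≈M : DifferInOne L M) where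

    ∣M∣ : length M ≡ k
    ∣M∣ = trans (sym (DifferInOne-length L≈M)) ∣L∣

    take-detour : take k (L ++ R) ≡ take k (L ++ M ++ L ++ R)
    take-detour = trans (take-++-of-length L R ∣L∣) (sym (take-++-of-length L (M ++ L ++ R) ∣L∣))

    detour-tight : setOf L ∈ₗ E → setOf M ∈ₗ E → TightWalk (P ++ L ++ R) → TightWalk (P ++ L ++ M ++ L ++ R)
    detour-tight L∈E M∈E tight = AllWindows-splice P take-detour tight
      (straddle-tight (L ++ R) ∣L∣ ∣M∣ (λ i _ → straddle-edge L≈M L∈E M∈E i)
        (straddle-tight R ∣M∣ ∣L∣ (λ i _ → straddle-edge (DifferInOne-sym L≈M) M∈E L∈E i)
          (AllWindows-++⁻ʳ P tight)))

    detour-visits : ∀ {c} → Visits (P ++ L ++ R) c → Visits (P ++ L ++ M ++ L ++ R) c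
    detour-visits = AnyWindow-splice P take-detour (AnyWindow-++⁺ʳ L ∘ AnyWindow-++⁺ʳ M)

    detour-visits-new : Visits (P ++ L ++ M ++ L ++ R) (setOf M)
    detour-visits-new = AnyWindow-++⁺ʳ P (AnyWindow-++⁺ʳ L
                          (Visits-here (M ++ L ++ R) (trans (cong length take≡M) ∣M∣ , cong setOf take≡M)))
      where
        take≡M : take k (M ++ L ++ R) ≡ M
        take≡M = take-++-of-length M (L ++ R) ∣M∣

    length-detour : length (P ++ L ++ M ++ L ++ R) ≡ 2 * k + length (P ++ L ++ R)
    length-detour = begin
      length (P ++ L ++ M ++ X)                     ≡⟨ length-insert P L (M ++ X) ⟩
      length L + length (P ++ M ++ X)               ≡⟨ cong (length L +_) (length-insert P M X) ⟩
      length L + (length M + length (P ++ X))       ≡⟨ +-assoc (length L) (length M) _ ⟨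
      length L + length M + length (P ++ X)         ≡⟨ cong (_+ length (P ++ X)) (cong₂ _+_ ∣L∣ ∣M∣) ⟩
      k + k + length (P ++ X)                       ≡⟨ cong (λ i → k + i + length (P ++ X)) (+-identityʳ k) ⟨
      2 * k + length (P ++ X)                       ∎
      where
        open ≡-Reasoning
        X = L ++ R

  record Cover (C : List (Subset n)) : Set where
    constructor cover
    field
      walk   : List (Fin n)
      tight  : TightWalk walk
      visits : All (Visits walk) C
      -- the first edge costs k vertices and each further edge 2k
      short  : length walk + k ≤ 2 * k * length C

  initial : ∀ {e} → e ∈ₗ E → Cover [ e ]
  initial {e} e∈E = cover L (TightWalk-edge ∣L∣ L∈E) (L-visits-e ∷ []) short
    where
      L = toList e
      ∣L∣ : length L ≡ k
      ∣L∣ = trans (length-toList e) (∣edge∣ e∈E)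
      L∈E : setOf L ∈ₗ E
      L∈E = subst (_∈ₗ E) (sym (setOf-toList e)) e∈E
      take≡L : take k L ≡ L
      take≡L = take-all k L (≤-reflexive ∣L∣)
      L-visits-e : Visits L e
      L-visits-e = Visits-here L (trans (cong length take≡L) ∣L∣ , trans (cong setOf take≡L) (setOf-toList e))
      short : length L + k ≤ 2 * k * 1
      short = ≤-reflexive (trans (cong (_+ k) ∣L∣)
                                 (sym (trans (*-identityʳ (2 * k)) (cong (k +_) (+-identityʳ k)))))

  extend : ∀ {C e f} → Cover C → e ∈ₗ C → LineAdj H e f → Cover (f ∷ C)
  extend {C} {e} {f} (cover w tight visits short) e∈C (e∈E , f∈E , ∣e∩f∣)
    with P , L , R , refl , ∣L∣ , L≡e ← Visits-split w (All.lookup visits e∈C)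
    with M , L≈M , M≡f ← exchange L ∣L∣ (trans (cong ∣_∣ L≡e) (∣edge∣ e∈E)) (∣edge∣ f∈E)
                                     (subst (λ s → ∣ s ∩ f ∣ ≡ j) (sym L≡e) ∣e∩f∣)
    = cover (P ++ L ++ M ++ L ++ R)
        (detour-tight (subst (_∈ₗ E) (sym L≡e) e∈E) (subst (_∈ₗ E) (sym M≡f) f∈E) tight)
        (subst (Visits _) M≡f detour-visits-new ∷ All.map detour-visits visits)
        short′
    where
      open Detour P R ∣L∣ L≈M
      short′ : length (P ++ L ++ M ++ L ++ R) + k ≤ 2 * k * suc (length C)
      short′ = begin
        length (P ++ L ++ M ++ L ++ R) + k     ≡⟨ cong (_+ k) length-detour ⟩
        2 * k + length (P ++ L ++ R) + k       ≡⟨ +-assoc (2 * k) _ k ⟩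
        2 * k + (length (P ++ L ++ R) + k)     ≤⟨ +-monoʳ-≤ (2 * k) short ⟩
        2 * k + 2 * k * length C               ≡⟨ *-suc (2 * k) (length C) ⟨
        2 * k * suc (length C)                 ∎
        where open ≤-Reasoning

  grow : ∀ {C c} → LineConnected → Cover C → All (_∈ₗ E) C → c ∈ₗ C →
         All (_∈ₗ C) E ⊎ ∃ λ f → f ∉ₗ C × f ∈ₗ E × Cover (f ∷ C)
  grow {C} {c} connected cov C⊆E c∈C with All.all? (_∈ₗ? C) E
  ... | yes E⊆C = inj₁ E⊆C
  ... | no  E⊈C
    with g , g∈E , g∉C ← find (¬All⇒Any¬ (_∈ₗ? C) E E⊈C)
    with e , f , e→f@(_ , f∈E , _) , e∈C , f∉C
           ← Star-exit (_∈ₗ? C) (connected c g (All.lookup C⊆E c∈C) g∈E) c∈C g∉C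
    = inj₂ (f , f∉C , f∈E , extend cov e∈C e→f)

  -- φ is fuel; it cannot run out because C grows by a new edge each step and has at most n ^ k
  saturate : ∀ φ {C c} → LineConnected → Cover C → Unique C → All (_∈ₗ E) C → c ∈ₗ C →
             n ^ k ≤ φ + length C → ∃ λ C → Cover C × length C ≤ n ^ k × All (_∈ₗ C) E
  saturate φ connected cov unique C⊆E c∈C fuel with grow connected cov C⊆E c∈C | φ
  ... | inj₁ E⊆C | _ = _ , cov , Unique⇒length≤n^k unique (All.map ∣edge∣ C⊆E) , E⊆C
  ... | inj₂ (f , f∉C , f∈E , cov′) | zero =
    contradiction fuel (<⇒≱ (Unique⇒length≤n^k (¬Any⇒All¬ _ f∉C ∷ unique) (All.map ∣edge∣ (f∈E ∷ C⊆E))))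
  ... | inj₂ (f , f∉C , f∈E , cov′) | suc φ′ =
    saturate φ′ connected cov′ (¬Any⇒All¬ _ f∉C ∷ unique) (f∈E ∷ C⊆E) (there c∈C)
             (subst (n ^ k ≤_) (sym (+-suc φ′ _)) fuel)

  tour : LineConnected → ∀ {e} → e ∈ₗ E → ∃ λ w → TightWalk w × length w ≤ n ^ (2 * k) × All (Visits w) E
  tour connected {e} e∈E
    with C , cover w tight visits short , ∣C∣≤n^k , E⊆C
           ← saturate (n ^ k) connected (initial e∈E) ([] ∷ []) (e∈E ∷ []) (here refl) (m≤m+n (n ^ k) 1)
    = w , tight , walk-length-bound j k≤n (≤-trans short (*-monoʳ-≤ (2 * k) ∣C∣≤n^k)) ,
      All.map (All.lookup visits) E⊆C
    where
      k≤n : k ≤ n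
      k≤n = subst (_≤ n) (∣edge∣ e∈E) (∣p∣≤n e)

  TightWalk⇒IsTightWalk : ∀ w → TightWalk w → IsTightWalk H w
  TightWalk⇒IsTightWalk (x ∷ w) (edge ∷ _)     zero    le        = edge (length-take≡ (x ∷ w) le)
  TightWalk⇒IsTightWalk (x ∷ w) (_    ∷ tight) (suc i) (s≤s le) = TightWalk⇒IsTightWalk w tight i le

  Visits⇒ContainsEdge : ∀ {e} w → Visits w e → ContainsEdge k w e
  Visits⇒ContainsEdge (x ∷ w) (here (∣t∣ , t≡e)) = 0 , length-take≡⁻ k (x ∷ w) ∣t∣ , t≡e
  Visits⇒ContainsEdge (x ∷ w) (there visits) =
    let i , i+k≤w , window≡e = Visits⇒ContainsEdge w visits in suc i , s≤s i+k≤w , window≡e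

open TightWalks using (tour; TightWalk⇒IsTightWalk; Visits⇒ContainsEdge)

lemma3p2 : (n k : ℕ) → 1 ≤ k → (H : KGraph n k) → TightlyConnected H →
    Σ (List (Fin n)) λ w →
      IsTightWalk H w × (length w ≤ n ^ (2 * k)) × All (ContainsEdge k w) (edges H)
lemma3p2 n (suc j) _ H@record { edges = [] } _ = [] , TightWalk⇒IsTightWalk H [] Windows.[] , z≤n , []
lemma3p2 n (suc j) _ H@record { edges = e ∷ _ } (_ , connected)
  with w , tight , ∣w∣≤ , visits ← tour H connected (here refl)
  = w , TightWalk⇒IsTightWalk H w tight , ∣w∣≤ , All.map (Visits⇒ContainsEdge H w) visits
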